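{- Let $R$ be a commutative ring, $h=(h_n)_{n>0}$ a sequence in $R$, and let $a>b>c>d\ge0$ be integers. Suppose that $h$ satisfies $$E(n,2,1,0):\quad h_{n+2}h_{n-2}h_1^2=h_2^2h_{n+1}h_{n-1}-h_3h_1h_n^2$$ for all integers $n$ with $3\le n\le a+b-2$, and that $h_n$ is not a zero-divisor in $R$ for every integer $1\le n\le a+b-4$. Then $h$ satisfies $E(a,b,c,d)$.
   Context: For a sequence $h=(h_n)_{n>0}$ in a commutative ring and integers $a>b>c>d\ge0$, the elliptic relation $E(a,b,c,d)$ is the identity $$h_{a+b}h_{a-b}h_{c+d}h_{c-d}=h_{a+c}h_{a-c}h_{b+d}h_{b-d}-h_{b+c}h_{b-c}h_{a+d}h_{a-d}.$$ -}

module Defs where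

open import Level using (_⊔_)
open import Data.Nat using (ℕ) renaming (_+_ to _+ℕ_; _∸_ to _∸ℕ_)
open import Algebra.Bundles using (CommutativeRing)

module _ {c ℓ} (R : CommutativeRing c ℓ) where
  open CommutativeRing R

  NotZeroDivisor : Carrier → Set (c ⊔ ℓ)
  NotZeroDivisor x = ∀ y → x * y ≈ 0# → y ≈ 0#

  -- The elliptic relation E(a,b,c,d) for a sequence h (indexed by ℕ; h 0 is
  -- never used when a > b > c > d ≥ 0, since all indices are then positive).
  Elliptic : (ℕ → Carrier) → ℕ → ℕ → ℕ → ℕ → Set ℓ
  Elliptic h a b c d =
    h (a +ℕ b) * h (a ∸ℕ b) * h (c +ℕ d) * h (c ∸ℕ d)
      ≈ h (a +ℕ c) * h (a ∸ℕ c) * h (b +ℕ d) * h (b ∸ℕ d)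
        - h (b +ℕ c) * h (b ∸ℕ c) * h (a +ℕ d) * h (a ∸ℕ d)

{-# OPTIONS --safe #-}
-- Let [u, v] be the determinant with rows (h (u + 1) h (u - 1), h u ²) and (h (v + 1) h (v - 1), h v ²).
-- Then E(u, v, 1, 0) reads h₁² h (u + v) h (u - v) = [u, v], and once this holds for every pair taken
-- from a > b > c > d, E(a, b, c, d) multiplied by h₁⁴ is the three-term Plücker relation between the
-- six determinants.  So it suffices to prove E(n, m, 1, 0) for n + m ≤ a + b, by induction on n + m.
-- For m ≤ 1 it holds by the conventions h 0 = 0, h (- 1) = - h 1, and for m = 2 it is a hypothesis.
-- For m ≥ 3, four relations of smaller weight say that a product of two 2 × 2 matrices is
-- h₁ h (n + m - 4) times a matrix of determinant [n, m]; comparing determinants gives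
-- [n + m - 2, 2] [n - 2, m - 2] = (h₁ h (n + m - 4))² [n, m], which together with E(n + m - 2, 2, 1, 0)
-- and E(n - 2, m - 2, 1, 0) yields E(n, m, 1, 0) after cancelling h₁ h (n + m - 4) twice.
module Submission where

open import Defs
open import Data.Nat using (ℕ; _+_; _∸_; _≤_; _<_)
open import Algebra.Bundles using (CommutativeRing)

open import Data.Nat.Base as ℕ using (zero; suc; s≤s; z≤n; z<s)
import Data.Nat.Properties as ℕ
import Data.Nat.Tactic.RingSolver as ℕ
open import Data.Integer.Base as ℤ using (ℤ; -[1+_])
import Data.Integer.Properties as ℤ
open import Data.Sign.Base as Sign using (Sign)
open import Data.List.Base using (_∷_; [])
open import Data.Maybe.Base using (Maybe; just; nothing)
open import Data.Product.Base using (∃-syntax; _,_)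
open import Data.Sum.Base using (_⊎_; inj₁; inj₂)
open import Relation.Nullary.Decidable using (yes; no)
import Relation.Binary.PropositionalEquality as ≡
open ≡ using (_≡_)
import Relation.Binary.Reasoning.Setoid as SetoidReasoning
open import Algebra.Solver.Ring.AlmostCommutativeRing using (_-Raw-AlmostCommutative⟶_; fromCommutativeRing)
import Algebra.Solver.Ring
import Algebra.Properties.Ring
import Algebra.Properties.Semiring.Mult

∸-by : ∀ m k {n} → m ≡ n + k → m ∸ k ≡ n
∸-by _ k {n} ≡.refl = ℕ.m+n∸n≡m n k

≤-by : ∀ {m n} k → n ≡ m + k → m ≤ n
≤-by {m} k ≡.refl = ℕ.m≤m+n m k

SameParity : ℕ → ℕ → Set
SameParity m n = ∃[ w ] (m ≡ n + w + w ⊎ n ≡ m + w + w)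

parity : ∀ n → ∃[ m ] (n ≡ m + m ⊎ n ≡ suc (m + m))
parity zero = 0 , inj₁ ≡.refl
parity (suc n) with parity n
... | m , inj₁ ≡.refl = m , inj₂ ≡.refl
... | m , inj₂ ≡.refl = suc m , inj₁ (≡.cong suc (≡.sym (ℕ.+-suc m m)))

sameParity : ∀ ρ a b → SameParity (ρ + (a + a)) (ρ + (b + b))
sameParity ρ a b with ℕ.≤-total a b
... | inj₁ a≤b with ℕ.m≤n⇒∃[o]m+o≡n a≤b
...   | w , ≡.refl = w , inj₂ (ℕ.solve (ρ ∷ a ∷ w ∷ []))
sameParity ρ a b | inj₂ b≤a with ℕ.m≤n⇒∃[o]m+o≡n b≤a
...   | w , ≡.refl = w , inj₁ (ℕ.solve (ρ ∷ b ∷ w ∷ []))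

pigeonhole : ∀ e i j → SameParity i j ⊎ SameParity e j ⊎ SameParity e i
pigeonhole e i j with parity e | parity i | parity j
... | a , inj₁ ≡.refl | b , inj₁ ≡.refl | c , inj₁ ≡.refl = inj₁ (sameParity 0 b c)
... | a , inj₁ ≡.refl | b , inj₁ ≡.refl | c , inj₂ ≡.refl = inj₂ (inj₂ (sameParity 0 a b))
... | a , inj₁ ≡.refl | b , inj₂ ≡.refl | c , inj₁ ≡.refl = inj₂ (inj₁ (sameParity 0 a c))
... | a , inj₁ ≡.refl | b , inj₂ ≡.refl | c , inj₂ ≡.refl = inj₁ (sameParity 1 b c)
... | a , inj₂ ≡.refl | b , inj₁ ≡.refl | c , inj₁ ≡.refl = inj₁ (sameParity 0 b c)
... | a , inj₂ ≡.refl | b , inj₁ ≡.refl | c , inj₂ ≡.refl = inj₂ (inj₁ (sameParity 1 a c))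
... | a , inj₂ ≡.refl | b , inj₂ ≡.refl | c , inj₁ ≡.refl = inj₂ (inj₂ (sameParity 1 a b))
... | a , inj₂ ≡.refl | b , inj₂ ≡.refl | c , inj₂ ≡.refl = inj₁ (sameParity 1 b c)

-- The ring solver needs coefficients with decidable equality; we use ℤ through its canonical map into R.
module IntegerCoefficients {c ℓ} (R : CommutativeRing c ℓ) where
  open CommutativeRing R renaming (_+_ to _⊕_)
  open Algebra.Properties.Ring ring using (-0#≈0#; -‿involutive; -‿+-comm; -‿distribˡ-*; -‿distribʳ-*)
  open Algebra.Properties.Semiring.Mult semiring using (_×_; ×-congˡ; ×-homo-+; ×1-homo-*)
  open SetoidReasoning setoid

  private
    ⟦_⟧ℤ : ℤ → Carrier
    ⟦ ℤ.+ n    ⟧ℤ = n × 1#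
    ⟦ -[1+ n ] ⟧ℤ = - (suc n × 1#)

    1+x-[1+y] : ∀ x y → (1# ⊕ x) - (1# ⊕ y) ≈ x - y
    1+x-[1+y] x y = begin
      (1# ⊕ x) - (1# ⊕ y)     ≈⟨ +-congˡ (-‿+-comm 1# y) ⟨
      (1# ⊕ x) ⊕ (- 1# - y)   ≈⟨ +-assoc 1# x _ ⟩
      1# ⊕ (x ⊕ (- 1# - y))   ≈⟨ +-congˡ (+-assoc x (- 1#) (- y)) ⟨
      1# ⊕ ((x - 1#) - y)     ≈⟨ +-congˡ (+-congʳ (+-comm x (- 1#))) ⟩
      1# ⊕ ((- 1# ⊕ x) - y)   ≈⟨ +-congˡ (+-assoc (- 1#) x (- y)) ⟩
      1# ⊕ (- 1# ⊕ (x - y))   ≈⟨ +-assoc 1# (- 1#) _ ⟨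
      (1# - 1#) ⊕ (x - y)     ≈⟨ +-congʳ (-‿inverseʳ 1#) ⟩
      0# ⊕ (x - y)            ≈⟨ +-identityˡ _ ⟩
      x - y                   ∎

    ⊖-homo : ∀ m n → ⟦ m ℤ.⊖ n ⟧ℤ ≈ m × 1# - n × 1#
    ⊖-homo zero    zero    = sym (-‿inverseʳ 0#)
    ⊖-homo zero    (suc n) = sym (+-identityˡ _)
    ⊖-homo (suc m) zero    = sym (trans (+-congˡ -0#≈0#) (+-identityʳ _))
    ⊖-homo (suc m) (suc n) rewrite ℤ.[1+m]⊖[1+n]≡m⊖n m n =
      trans (⊖-homo m n) (sym (1+x-[1+y] (m × 1#) (n × 1#)))

    +-homo : ∀ i j → ⟦ i ℤ.+ j ⟧ℤ ≈ ⟦ i ⟧ℤ ⊕ ⟦ j ⟧ℤ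
    +-homo -[1+ m ] -[1+ n ] = sym (trans (-‿+-comm _ _)
      (-‿cong (trans (sym (×-homo-+ 1# (suc m) (suc n))) (×-congˡ (≡.cong suc (ℕ.+-suc m n))))))
    +-homo -[1+ m ] (ℤ.+ n)  = trans (⊖-homo n (suc m)) (+-comm _ _)
    +-homo (ℤ.+ m)  -[1+ n ] = ⊖-homo m (suc n)
    +-homo (ℤ.+ m)  (ℤ.+ n)  = ×-homo-+ 1# m n

    signed : Sign → Carrier → Carrier
    signed Sign.+ x = x
    signed Sign.- x = - x

    signed-cong : ∀ s {x y} → x ≈ y → signed s x ≈ signed s y
    signed-cong Sign.+ x≈y = x≈y
    signed-cong Sign.- x≈y = -‿cong x≈y

    signed-* : ∀ s t x y → signed (s Sign.* t) (x * y) ≈ signed s x * signed t y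
    signed-* Sign.+ Sign.+ x y = refl
    signed-* Sign.+ Sign.- x y = -‿distribʳ-* x y
    signed-* Sign.- Sign.+ x y = -‿distribˡ-* x y
    signed-* Sign.- Sign.- x y =
      trans (sym (-‿involutive (x * y))) (trans (-‿cong (-‿distribˡ-* x y)) (-‿distribʳ-* (- x) y))

    ◃-homo : ∀ s n → ⟦ s ℤ.◃ n ⟧ℤ ≈ signed s (n × 1#)
    ◃-homo Sign.+ zero    = refl
    ◃-homo Sign.- zero    = sym -0#≈0#
    ◃-homo Sign.+ (suc n) = refl
    ◃-homo Sign.- (suc n) = refl

    signed-abs : ∀ i → ⟦ i ⟧ℤ ≈ signed (ℤ.sign i) (ℤ.∣ i ∣ × 1#)
    signed-abs (ℤ.+ n)  = refl
    signed-abs -[1+ n ] = refl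

    *-homo : ∀ i j → ⟦ i ℤ.* j ⟧ℤ ≈ ⟦ i ⟧ℤ * ⟦ j ⟧ℤ
    *-homo i j = begin
      ⟦ i ℤ.* j ⟧ℤ                                  ≈⟨ ◃-homo (s Sign.* t) (ℤ.∣ i ∣ ℕ.* ℤ.∣ j ∣) ⟩
      signed (s Sign.* t) ((ℤ.∣ i ∣ ℕ.* ℤ.∣ j ∣) × 1#) ≈⟨ signed-cong (s Sign.* t) (×1-homo-* ℤ.∣ i ∣ ℤ.∣ j ∣) ⟩
      signed (s Sign.* t) ((ℤ.∣ i ∣ × 1#) * (ℤ.∣ j ∣ × 1#)) ≈⟨ signed-* s t _ _ ⟩
      signed s (ℤ.∣ i ∣ × 1#) * signed t (ℤ.∣ j ∣ × 1#)   ≈⟨ *-cong (signed-abs i) (signed-abs j) ⟨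
      ⟦ i ⟧ℤ * ⟦ j ⟧ℤ                                ∎
      where
      s = ℤ.sign i
      t = ℤ.sign j

    -‿homo : ∀ i → ⟦ ℤ.- i ⟧ℤ ≈ - ⟦ i ⟧ℤ
    -‿homo -[1+ n ]      = sym (-‿involutive _)
    -‿homo (ℤ.+ zero)    = sym -0#≈0#
    -‿homo (ℤ.+ (suc n)) = refl

    morphism : ℤ.+-*-rawRing -Raw-AlmostCommutative⟶ fromCommutativeRing R
    morphism = record
      { ⟦_⟧ = ⟦_⟧ℤ ; +-homo = +-homo ; *-homo = *-homo ; -‿homo = -‿homo
      ; 0-homo = refl ; 1-homo = +-identityʳ 1# }

    coefficient≟ : ∀ i j → Maybe (⟦ i ⟧ℤ ≈ ⟦ j ⟧ℤ)
    coefficient≟ i j with i ℤ.≟ j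
    ... | yes ≡.refl = just refl
    ... | no _       = nothing

  open Algebra.Solver.Ring ℤ.+-*-rawRing (fromCommutativeRing R) morphism coefficient≟ public

module EllipticSequences {c ℓ} (R : CommutativeRing c ℓ) where
  open CommutativeRing R hiding (_+_; zero)
  open Algebra.Properties.Ring ring using (x≈y⇒x∙y⁻¹≈ε; x∙y⁻¹≈ε⇒x≈y; x[y-z]≈xy-xz)
  open IntegerCoefficients R using (Polynomial; solve; _:=_; _:*_; _:-_; :-_; con)
  open SetoidReasoning setoid

  NZD : Carrier → Set _
  NZD = NotZeroDivisor R

  *-notZeroDivisor : ∀ {x y} → NZD x → NZD y → NZD (x * y)
  *-notZeroDivisor {x} {y} nzx nzy z xyz≈0 = nzy z (nzx (y * z) (trans (sym (*-assoc x y z)) xyz≈0))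

  notZeroDivisor-cancelˡ : ∀ {x y z} → NZD x → x * y ≈ x * z → y ≈ z
  notZeroDivisor-cancelˡ {x} {y} {z} nzx xy≈xz =
    x∙y⁻¹≈ε⇒x≈y y z (nzx (y - z) (trans (x[y-z]≈xy-xz x y z) (x≈y⇒x∙y⁻¹≈ε xy≈xz)))

  cancel-through : ∀ {k a b c x y z} → NZD k → NZD c →
    k * k * (a * c) ≈ x → k * k * (c * b) ≈ y → x * y ≈ c * k * (c * k) * z → k * k * (a * b) ≈ z
  cancel-through {k} {a} {b} {c} {x} {y} {z} nzk nzc kkac≈x kkcb≈y xy≈ckckz =
    notZeroDivisor-cancelˡ (*-notZeroDivisor nzck nzck) (begin
      c * k * (c * k) * (k * k * (a * b))  ≈⟨ solve 4 (λ k a b c →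
                                                c :* k :* (c :* k) :* (k :* k :* (a :* b))
                                                := k :* k :* (a :* c) :* (k :* k :* (c :* b))) refl k a b c ⟩
      k * k * (a * c) * (k * k * (c * b))  ≈⟨ *-cong kkac≈x kkcb≈y ⟩
      x * y                                ≈⟨ xy≈ckckz ⟩
      c * k * (c * k) * z                  ∎)
    where nzck = *-notZeroDivisor nzc nzk

  -‿cong₂ : ∀ {x x′ y y′} → x ≈ x′ → y ≈ y′ → x - y ≈ x′ - y′
  -‿cong₂ x≈x′ y≈y′ = +-cong x≈x′ (-‿cong y≈y′)

  three-term-cong : ∀ {x x′ y y′ z z′} → x ≈ y - z → x ≈ x′ → y ≈ y′ → z ≈ z′ → x′ ≈ y′ - z′
  three-term-cong x≈y-z x≈x′ y≈y′ z≈z′ = trans (sym x≈x′) (trans x≈y-z (-‿cong₂ y≈y′ z≈z′))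

  three-term-difference : ∀ {p₁ p₂ p₃ p₄ q₁ q₂ q₃ q₄ z₁ z₂ z₃ z₄} →
    p₁ * p₂ * p₃ * p₄ ≈ q₁ * q₂ * q₃ * q₄ - z₁ * z₂ * z₃ * z₄ →
    q₁ * q₂ * (q₃ * q₄) - p₁ * p₂ * (p₃ * p₄) ≈ z₁ * z₂ * (z₃ * z₄)
  three-term-difference {p₁} {p₂} {p₃} {p₄} {q₁} {q₂} {q₃} {q₄} {z₁} {z₂} {z₃} {z₄} p≈q-z = begin
    q₁ * q₂ * (q₃ * q₄) - p₁ * p₂ * (p₃ * p₄)  ≈⟨ -‿cong₂ (*-assoc _ _ _) (*-assoc _ _ _) ⟨
    q - p                                      ≈⟨ -‿cong₂ refl p≈q-z ⟩
    q - (q - z)                                ≈⟨ solve 2 (λ q z → q :- (q :- z) := z) refl q z ⟩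
    z                                          ≈⟨ *-assoc _ _ _ ⟩
    z₁ * z₂ * (z₃ * z₄)                        ∎
    where
    p = p₁ * p₂ * p₃ * p₄
    q = q₁ * q₂ * q₃ * q₄
    z = z₁ * z₂ * z₃ * z₄

  swap₂₃ : ∀ {a b c d} → a * b * c * d ≈ a * c * b * d
  swap₂₃ = solve 4 (λ a b c d → a :* b :* c :* d := a :* c :* b :* d) refl _ _ _ _

  swap₃₄ : ∀ {a b c d} → a * b * c * d ≈ a * b * d * c
  swap₃₄ = solve 4 (λ a b c d → a :* b :* c :* d := a :* b :* d :* c) refl _ _ _ _

  swap₁₄ : ∀ {a b c d} → a * b * c * d ≈ d * b * c * a
  swap₁₄ = solve 4 (λ a b c d → a :* b :* c :* d := d :* b :* c :* a) refl _ _ _ _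

  det : Carrier → Carrier → Carrier → Carrier → Carrier
  det a b c d = a * d - b * c

  :det : ∀ {n} → Polynomial n → Polynomial n → Polynomial n → Polynomial n → Polynomial n
  :det a b c d = a :* d :- b :* c

  det-cong : ∀ {a a′ b b′ c c′ d d′} → a ≈ a′ → b ≈ b′ → c ≈ c′ → d ≈ d′ → det a b c d ≈ det a′ b′ c′ d′
  det-cong a≈a′ b≈b′ c≈c′ d≈d′ = -‿cong₂ (*-cong a≈a′ d≈d′) (*-cong b≈b′ c≈c′)

  det-plücker : ∀ a b c d e f g k →
    det a b c d * det e f g k ≈ det a b e f * det c d g k - det c d e f * det a b g k
  det-plücker = solve 8 (λ a b c d e f g k →
    :det a b c d :* :det e f g k := :det a b e f :* :det c d g k :- :det c d e f :* :det a b g k) refl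

  module _ (h : ℕ → Carrier) where

    square : ℕ → Carrier
    square n = h n * h n

    -- h (n + 1) * h (n - 1) for the odd extension of h to ℤ, with h 0 = 0 and h (- 1) = - h 1.
    neighbours : ℕ → Carrier
    neighbours zero    = - (h 1 * h 1)
    neighbours (suc n) = h (2 + n) * h n

    bracket : ℕ → ℕ → Carrier
    bracket u v = det (neighbours u) (square u) (neighbours v) (square v)

    -- E(u, v, 1, 0), extended to v ∈ {0, 1} by the conventions of neighbours.
    Elliptic₁₀ : ℕ → ℕ → Set ℓ
    Elliptic₁₀ u v = h 1 * h 1 * (h (u + v) * h (u ∸ v)) ≈ bracket u v

    elliptic⇒elliptic₁₀ : ∀ u v → Elliptic R h (suc u) (suc v) 1 0 → Elliptic₁₀ (suc u) (suc v)
    elliptic⇒elliptic₁₀ u v e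
      rewrite ℕ.+-identityʳ u | ℕ.+-identityʳ v | ℕ.+-comm u 1 | ℕ.+-comm v 1 = begin
      h 1 * h 1 * (h (suc u + suc v) * h (u ∸ v))
        ≈⟨ solve 3 (λ x y z → z :* z :* (x :* y) := x :* y :* z :* z) refl _ _ _ ⟩
      h (suc u + suc v) * h (u ∸ v) * h 1 * h 1
        ≈⟨ e ⟩
      h (2 + u) * h u * h (suc v) * h (suc v) - h (2 + v) * h v * h (suc u) * h (suc u)
        ≈⟨ solve 6 (λ a b c d e f → a :* b :* c :* c :- d :* e :* f :* f
                                    := :det (a :* b) (f :* f) (d :* e) (c :* c)) refl _ _ _ _ _ _ ⟩
      bracket (suc u) (suc v)
        ∎

    elliptic₁₀⇒elliptic : ∀ {a b c d} → NZD (h 1) →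
      Elliptic₁₀ a b → Elliptic₁₀ a c → Elliptic₁₀ a d → Elliptic₁₀ b c → Elliptic₁₀ b d → Elliptic₁₀ c d →
      Elliptic R h a b c d
    elliptic₁₀⇒elliptic {a} {b} {c} {d} nz E-ab E-ac E-ad E-bc E-bd E-cd =
      notZeroDivisor-cancelˡ (*-notZeroDivisor nz² nz²) (begin
        h₁² * h₁² * (h (a + b) * h (a ∸ b) * h (c + d) * h (c ∸ d))
          ≈⟨ regroup _ _ _ _ ⟩
        h₁² * pair a b * (h₁² * pair c d)
          ≈⟨ *-cong E-ab E-cd ⟩
        bracket a b * bracket c d
          ≈⟨ det-plücker _ _ _ _ _ _ _ _ ⟩
        bracket a c * bracket b d - bracket b c * bracket a d
          ≈⟨ -‿cong₂ (*-cong E-ac E-bd) (*-cong E-bc E-ad) ⟨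
        h₁² * pair a c * (h₁² * pair b d) - h₁² * pair b c * (h₁² * pair a d)
          ≈⟨ -‿cong₂ (regroup _ _ _ _) (regroup _ _ _ _) ⟨
        h₁² * h₁² * (h (a + c) * h (a ∸ c) * h (b + d) * h (b ∸ d))
          - h₁² * h₁² * (h (b + c) * h (b ∸ c) * h (a + d) * h (a ∸ d))
          ≈⟨ x[y-z]≈xy-xz _ _ _ ⟨
        h₁² * h₁² * (h (a + c) * h (a ∸ c) * h (b + d) * h (b ∸ d)
          - h (b + c) * h (b ∸ c) * h (a + d) * h (a ∸ d))
          ∎)
      where
      h₁² = h 1 * h 1
      nz² = *-notZeroDivisor nz nz
      pair : ℕ → ℕ → Carrier
      pair u v = h (u + v) * h (u ∸ v)
      regroup : ∀ w x y z → h₁² * h₁² * (w * x * y * z) ≈ h₁² * (w * x) * (h₁² * (y * z))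
      regroup = solve 5 (λ k w x y z → k :* k :* (w :* x :* y :* z) := k :* (w :* x) :* (k :* (y :* z)))
                  refl h₁²

    Elliptic₁₀Below : ℕ → Set ℓ
    Elliptic₁₀Below N = ∀ {u v} → v < u → u + v < N → Elliptic₁₀ u v

    EllipticBelow : ℕ → Set ℓ
    EllipticBelow N = ∀ {a b c d} → d < c → c < b → b < a → a + b < N → Elliptic R h a b c d

    elliptic₁₀Below⇒ellipticBelow : ∀ {N} → NZD (h 1) → Elliptic₁₀Below N → EllipticBelow N
    elliptic₁₀Below⇒ellipticBelow {N} nz below {a} {b} d<c c<b b<a a+b<N =
      elliptic₁₀⇒elliptic nz (below b<a a+b<N)
        (below c<a (bounded ℕ.≤-refl c≤b)) (below d<a (bounded ℕ.≤-refl d≤b))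
        (below c<b (bounded b≤a c≤b)) (below d<b (bounded b≤a d≤b)) (below d<c (bounded c≤a d≤b))
      where
      bounded : ∀ {u v} → u ≤ a → v ≤ b → u + v < N
      bounded u≤a v≤b = ℕ.≤-<-trans (ℕ.+-mono-≤ u≤a v≤b) a+b<N
      d<b = ℕ.<-trans d<c c<b
      c<a = ℕ.<-trans c<b b<a
      d<a = ℕ.<-trans d<b b<a
      b≤a = ℕ.<⇒≤ b<a
      c≤a = ℕ.<⇒≤ c<a
      c≤b = ℕ.<⇒≤ c<b
      d≤b = ℕ.<⇒≤ d<b

    product-≡ : ∀ {i₁ i₂ i₃ i₄ j₁ j₂ j₃ j₄} → i₁ ≡ j₁ → i₂ ≡ j₂ → i₃ ≡ j₃ → i₄ ≡ j₄ →
      h i₁ * h i₂ * h i₃ * h i₄ ≈ h j₁ * h j₂ * h j₃ * h j₄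
    product-≡ ≡.refl ≡.refl ≡.refl ≡.refl = refl

    -- E(a, b, c, d) in the variables y = b - c, e = a - b, i = c + d and j = c - d.  In this form
    -- it makes sense without the constraint i ≡ j (mod 2), and it is symmetric in e, i and j.
    EllipticSym : ℕ → ℕ → ℕ → ℕ → Set ℓ
    EllipticSym y e i j =
      h (y + y + e + (i + j)) * h e * h i * h j
        ≈ h (y + e + (i + j)) * h (y + e) * h (y + i) * h (y + j)
          - h (y + (i + j)) * h y * h (y + e + i) * h (y + e + j)

    elliptic⇒ellipticSym : ∀ {y e j w} →
      Elliptic R h (y + e + (j + w)) (y + (j + w)) (j + w) w → EllipticSym y e (j + w + w) j
    elliptic⇒ellipticSym {y} {e} {j} {w} E =
      three-term-cong E (product-≡ a+b a∸b ≡.refl c∸d) (product-≡ a+c a∸c b+d b∸d)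
                        (product-≡ b+c b∸c a+d a∸d)
      where
      a+b : y + e + (j + w) + (y + (j + w)) ≡ y + y + e + (j + w + w + j)
      a+b = ℕ.solve (y ∷ e ∷ j ∷ w ∷ [])
      a∸b : y + e + (j + w) ∸ (y + (j + w)) ≡ e
      a∸b = ∸-by (y + e + (j + w)) (y + (j + w)) (ℕ.solve (y ∷ e ∷ j ∷ w ∷ []))
      c∸d : j + w ∸ w ≡ j
      c∸d = ℕ.m+n∸n≡m j w
      a+c : y + e + (j + w) + (j + w) ≡ y + e + (j + w + w + j)
      a+c = ℕ.solve (y ∷ e ∷ j ∷ w ∷ [])
      a∸c : y + e + (j + w) ∸ (j + w) ≡ y + e
      a∸c = ℕ.m+n∸n≡m (y + e) (j + w)
      b+d : y + (j + w) + w ≡ y + (j + w + w)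
      b+d = ℕ.+-assoc y (j + w) w
      b∸d : y + (j + w) ∸ w ≡ y + j
      b∸d = ∸-by (y + (j + w)) w (ℕ.solve (y ∷ j ∷ w ∷ []))
      b+c : y + (j + w) + (j + w) ≡ y + (j + w + w + j)
      b+c = ℕ.solve (y ∷ j ∷ w ∷ [])
      b∸c : y + (j + w) ∸ (j + w) ≡ y
      b∸c = ℕ.m+n∸n≡m y (j + w)
      a+d : y + e + (j + w) + w ≡ y + e + (j + w + w)
      a+d = ℕ.+-assoc (y + e) (j + w) w
      a∸d : y + e + (j + w) ∸ w ≡ y + e + j
      a∸d = ∸-by (y + e + (j + w)) w (ℕ.solve (y ∷ e ∷ j ∷ w ∷ []))

    ellipticSym-swapᵢⱼ : ∀ {y e i j} → EllipticSym y e i j → EllipticSym y e j i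
    ellipticSym-swapᵢⱼ {i = i} {j} s rewrite ℕ.+-comm j i = three-term-cong s swap₃₄ swap₃₄ swap₃₄

    ellipticSym-swapₑᵢ : ∀ {y e i j} → EllipticSym y e i j → EllipticSym y i e j
    ellipticSym-swapₑᵢ {y} {e} {i} {j} s = three-term-cong s
      (trans (product-≡ outer ≡.refl ≡.refl ≡.refl) swap₂₃)
      (trans (product-≡ middle ≡.refl ≡.refl ≡.refl) swap₂₃)
      (trans (product-≡ (≡.sym (ℕ.+-assoc y i j)) ≡.refl inner (ℕ.+-assoc y e j)) swap₁₄)
      where
      outer : y + y + e + (i + j) ≡ y + y + i + (e + j)
      outer = ℕ.solve (y ∷ e ∷ i ∷ j ∷ [])
      middle : y + e + (i + j) ≡ y + i + (e + j)
      middle = ℕ.solve (y ∷ e ∷ i ∷ j ∷ [])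
      inner : y + e + i ≡ y + i + e
      inner = ℕ.solve (y ∷ e ∷ i ∷ [])

    ellipticSym-difference : ∀ {y e i j s} → i + j ≡ s → EllipticSym y e i j →
      h (y + e + s) * h (y + e) * (h (y + i) * h (y + j)) - h (y + y + e + s) * h e * (h i * h j)
        ≈ h (y + s) * h y * (h (y + e + i) * h (y + e + j))
    ellipticSym-difference ≡.refl = three-term-difference

    -- With n = 4 + k + t, m = 3 + k and N = n + m = 7 + S, the four hypotheses are the entries of the identity
    --   [[h(N-2) h 3, h(N-1) h 2], [h(N-3) h 2, h(N-2) h 1]]
    --     · [[h(n-1) h(m-2), h(n-2) h(m-1)], [- h(n-2) h(m-3), - h(n-3) h(m-2)]]
    --   = h(N-4) h 1 · [[h(n+1) h m, h n h(m+1)], [h n h(m-1), h(n-1) h m]],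
    -- and the statement compares the determinants of both sides.
    bracket-step : ∀ k t → let S = k + t + k in
      EllipticSym 1 2 (2 + k + t) k → EllipticSym 1 2 (1 + k + t) (1 + k) →
      EllipticSym 1 1 (2 + k + t) k → EllipticSym 1 1 (1 + k + t) (1 + k) →
      bracket (5 + S) 2 * bracket (2 + k + t) (1 + k)
        ≈ h (3 + S) * h 1 * (h (3 + S) * h 1) * bracket (4 + k + t) (3 + k)
    bracket-step k t α β γ δ = begin
      bracket (5 + S) 2 * bracket (2 + k + t) (1 + k)
        ≈⟨ solve 12 (λ hN₁ hN₂ hN₃ h₁ h₂ h₃ n₁ n₂ n₃ m₁ m₂ m₃ →
             let A = hN₁ :* h₂; B = hN₂ :* h₃; C = hN₂ :* h₁; D = hN₃ :* h₂
                 u₁ = n₂ :* m₃; u₂ = n₁ :* m₂; v₁ = n₃ :* m₂; v₂ = n₂ :* m₁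
             in :det (hN₁ :* hN₃) (hN₂ :* hN₂) (h₃ :* h₁) (h₂ :* h₂)
                  :* :det (n₁ :* n₃) (n₂ :* n₂) (m₁ :* m₃) (m₂ :* m₂)
                := :det (B :* u₂ :- A :* u₁) (B :* v₂ :- A :* v₁)
                        (D :* u₂ :- C :* u₁) (D :* v₂ :- C :* v₁))
             refl (h (6 + S)) (h (5 + S)) (h (4 + S)) (h 1) (h 2) (h 3)
                  (h (3 + k + t)) (h (2 + k + t)) (h (1 + k + t)) (h (2 + k)) (h (1 + k)) (h k) ⟩
      det (B * u₂ - A * u₁) (B * v₂ - A * v₁) (D * u₂ - C * u₁) (D * v₂ - C * v₁)
        ≈⟨ det-cong (ellipticSym-difference ≡.refl α) (ellipticSym-difference i+j≡ β)
                    (ellipticSym-difference ≡.refl γ) (ellipticSym-difference i+j≡ δ) ⟩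
      det (K * X₁₁) (K * X₁₂) (K * X₂₁) (K * X₂₂)
        ≈⟨ solve 7 (λ κ n₊ n₀ n₋ m₊ m₀ m₋ →
             :det (κ :* (n₊ :* m₀)) (κ :* (n₀ :* m₊)) (κ :* (n₀ :* m₋)) (κ :* (n₋ :* m₀))
             := κ :* κ :* :det (n₊ :* n₋) (n₀ :* n₀) (m₊ :* m₋) (m₀ :* m₀))
             refl K (h (5 + k + t)) (h (4 + k + t)) (h (3 + k + t)) (h (4 + k)) (h (3 + k)) (h (2 + k)) ⟩
      K * K * bracket (4 + k + t) (3 + k)
        ∎
      where
      S = k + t + k
      i+j≡ : 1 + k + t + (1 + k) ≡ 2 + S
      i+j≡ = ≡.cong suc (ℕ.+-suc (k + t) k)
      A = h (6 + S) * h 2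
      B = h (5 + S) * h 3
      C = h (5 + S) * h 1
      D = h (4 + S) * h 2
      K = h (3 + S) * h 1
      u₁ = h (2 + k + t) * h k
      u₂ = h (3 + k + t) * h (1 + k)
      v₁ = h (1 + k + t) * h (1 + k)
      v₂ = h (2 + k + t) * h (2 + k)
      X₁₁ = h (5 + k + t) * h (3 + k)
      X₁₂ = h (4 + k + t) * h (4 + k)
      X₂₁ = h (4 + k + t) * h (2 + k)
      X₂₂ = h (3 + k + t) * h (3 + k)

    module _ (h₀≈0 : h 0 ≈ 0#) where

      elliptic₁₀-zero : ∀ u → Elliptic₁₀ u 0
      elliptic₁₀-zero u rewrite ℕ.+-identityʳ u = begin
        h 1 * h 1 * (h u * h u)
          ≈⟨ solve 3 (λ k n s → k :* s := :det n s (:- k) (con (ℤ.+ 0))) refl _ _ _ ⟩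
        det (neighbours u) (square u) (- (h 1 * h 1)) 0#
          ≈⟨ det-cong refl refl refl (trans (*-congʳ h₀≈0) (zeroˡ _)) ⟨
        bracket u 0
          ∎

      elliptic₁₀-one : ∀ u → Elliptic₁₀ (suc u) 1
      elliptic₁₀-one u rewrite ℕ.+-comm u 1 = begin
        h 1 * h 1 * (h (2 + u) * h u)
          ≈⟨ solve 3 (λ k n s → k :* n := :det n s (con (ℤ.+ 0)) k) refl _ _ _ ⟩
        det (neighbours (suc u)) (square (suc u)) 0# (h 1 * h 1)
          ≈⟨ det-cong refl refl (trans (*-congˡ h₀≈0) (zeroʳ _)) refl ⟨
        bracket (suc u) 1
          ∎

      ellipticSym-zeroʳ : ∀ {y e i} → EllipticSym y e i 0
      ellipticSym-zeroʳ {y} {e} {i}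
        rewrite ℕ.+-identityʳ i | ℕ.+-identityʳ y | ℕ.+-identityʳ (y + e) = begin
        h (y + y + e + i) * h e * h i * h 0
          ≈⟨ trans (*-congˡ h₀≈0) (zeroʳ _) ⟩
        0#
          ≈⟨ x≈y⇒x∙y⁻¹≈ε (solve 4 (λ a b c d → a :* b :* c :* d := c :* d :* a :* b) refl _ _ _ _) ⟨
        h (y + e + i) * h (y + e) * h (y + i) * h y - h (y + i) * h y * h (y + e + i) * h (y + e)
          ∎

      ellipticSym-sameParity : ∀ {y e i j N} → 0 < y → 0 < e → 0 < i → 0 < j → EllipticBelow N →
        y + y + e + (i + j) < N → SameParity i j → EllipticSym y e i j
      ellipticSym-sameParity {y} {e} {j = j} {N} 0<y 0<e _ 0<j below bound (w , inj₁ ≡.refl) =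
        elliptic⇒ellipticSym (below d<c c<b b<a (≡.subst (_< N) (≡.sym a+b) bound))
        where
        d<c : w < j + w
        d<c = ℕ.m<n+m w 0<j
        c<b : j + w < y + (j + w)
        c<b = ℕ.m<n+m (j + w) 0<y
        b<a : y + (j + w) < y + e + (j + w)
        b<a = ℕ.+-monoˡ-< (j + w) (ℕ.m<m+n y 0<e)
        a+b : y + e + (j + w) + (y + (j + w)) ≡ y + y + e + (j + w + w + j)
        a+b = ℕ.solve (y ∷ e ∷ j ∷ w ∷ [])
      ellipticSym-sameParity {y} {e} {i} {j} {N} 0<y 0<e 0<i 0<j below bound (w , inj₂ ≡.refl) =
        ellipticSym-swapᵢⱼ (ellipticSym-sameParity 0<y 0<e 0<j 0<i below bound′ (w , inj₁ ≡.refl))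
        where bound′ = ≡.subst (λ s → y + y + e + s < N) (ℕ.+-comm i j) bound

      ellipticBelow⇒ellipticSym : ∀ {y e i j N} → 0 < y → EllipticBelow N → y + y + e + (i + j) < N →
        EllipticSym y e i j
      ellipticBelow⇒ellipticSym {j = zero} _ _ _ = ellipticSym-zeroʳ
      ellipticBelow⇒ellipticSym {i = zero} {suc j} _ _ _ = ellipticSym-swapᵢⱼ ellipticSym-zeroʳ
      ellipticBelow⇒ellipticSym {e = zero} {suc i} {suc j} _ _ _ =
        ellipticSym-swapₑᵢ (ellipticSym-swapᵢⱼ ellipticSym-zeroʳ)
      ellipticBelow⇒ellipticSym {y} {suc e} {suc i} {suc j} {N} 0<y below bound
        with pigeonhole (suc e) (suc i) (suc j)
      ... | inj₁ i∼j = ellipticSym-sameParity 0<y z<s z<s z<s below bound i∼j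
      ... | inj₂ (inj₁ e∼j) =
        ellipticSym-swapₑᵢ (ellipticSym-sameParity 0<y z<s z<s z<s below (≡.subst (_< N) iej bound) e∼j)
        where
        iej : y + y + suc e + (suc i + suc j) ≡ y + y + suc i + (suc e + suc j)
        iej = ℕ.solve (y ∷ e ∷ i ∷ j ∷ [])
      ... | inj₂ (inj₂ e∼i) =
        ellipticSym-swapᵢⱼ (ellipticSym-swapₑᵢ
          (ellipticSym-sameParity 0<y z<s z<s z<s below (≡.subst (_< N) jei bound) e∼i))
        where
        jei : y + y + suc e + (suc i + suc j) ≡ y + y + suc j + (suc e + suc i)
        jei = ℕ.solve (y ∷ e ∷ i ∷ j ∷ [])

      elliptic₁₀-step : ∀ {n m} → 3 ≤ m → m < n →
        (∀ {i} → 2 < i → i ≤ n + m ∸ 2 → Elliptic R h i 2 1 0) →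
        (∀ {i} → 0 < i → i ≤ n + m ∸ 4 → NZD (h i)) →
        Elliptic₁₀Below (n + m) → Elliptic₁₀ n m
      elliptic₁₀-step (s≤s (s≤s (s≤s {n = k} z≤n))) m<n E₂ nz below with ℕ.m≤n⇒∃[o]m+o≡n m<n
      ... | t , ≡.refl =
        reindex (≡.sym N≡) (≡.sym n∸m≡)
          (cancel-through nz₁ (nz z<s (ℕ.≤-reflexive (≡.sym N-4≡)))
            (reindex (ℕ.+-comm (5 + S) 2) ≡.refl
              (elliptic⇒elliptic₁₀ (4 + S) 1 (E₂ (s≤s (s≤s (s≤s z≤n))) (ℕ.≤-reflexive (≡.sym N-2≡)))))
            (reindex n₂+m₂≡ n₂∸m₂≡ (below′ (s≤s (s≤s (ℕ.m≤m+n k t))) (≤-by 3 n₂+m₂-bound)))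
            (bracket-step k t (ellipticSym< ℕ.≤-refl) (ellipticSym< (≤-by 0 β-bound))
                              (ellipticSym< (ℕ.n≤1+n _)) (ellipticSym< (≤-by 1 δ-bound))))
        where
        S = k + t + k
        N-4≡ : k + t + (3 + k) ≡ 3 + (k + t + k)
        N-4≡ = ℕ.solve (k ∷ t ∷ [])
        N-2≡ : 2 + (k + t + (3 + k)) ≡ 5 + S
        N-2≡ = ≡.cong (2 +_) N-4≡
        N≡ : 4 + k + t + (3 + k) ≡ 7 + S
        N≡ = ≡.cong (4 +_) N-4≡
        n∸m≡ : 4 + k + t ∸ (3 + k) ≡ 1 + t
        n∸m≡ = ∸-by (4 + k + t) (3 + k) (ℕ.solve (k ∷ t ∷ []))
        n₂+m₂≡ : 2 + k + t + (1 + k) ≡ 3 + (k + t + k)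
        n₂+m₂≡ = ℕ.solve (k ∷ t ∷ [])
        n₂∸m₂≡ : 2 + k + t ∸ (1 + k) ≡ 1 + t
        n₂∸m₂≡ = ∸-by (2 + k + t) (1 + k) (ℕ.solve (k ∷ t ∷ []))
        n₂+m₂-bound : 7 + (k + t + k) ≡ suc (2 + k + t + (1 + k)) + 3
        n₂+m₂-bound = ℕ.solve (k ∷ t ∷ [])
        β-bound : 7 + (k + t + k) ≡ suc (4 + (1 + k + t + (1 + k))) + 0
        β-bound = ℕ.solve (k ∷ t ∷ [])
        δ-bound : 7 + (k + t + k) ≡ suc (3 + (1 + k + t + (1 + k))) + 1
        δ-bound = ℕ.solve (k ∷ t ∷ [])
        below′ : Elliptic₁₀Below (7 + S)
        below′ = ≡.subst Elliptic₁₀Below N≡ below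
        nz₁ : NZD (h 1)
        nz₁ = nz z<s (ℕ.≤-trans (s≤s z≤n) (ℕ.≤-reflexive (≡.sym N-4≡)))
        ellipticSym< : ∀ {e i j} → 1 + 1 + e + (i + j) < 7 + S → EllipticSym 1 e i j
        ellipticSym< = ellipticBelow⇒ellipticSym z<s (elliptic₁₀Below⇒ellipticBelow nz₁ below′)
        reindex : ∀ {u v s s′ δ δ′} → s ≡ s′ → δ ≡ δ′ →
          h 1 * h 1 * (h s * h δ) ≈ bracket u v → h 1 * h 1 * (h s′ * h δ′) ≈ bracket u v
        reindex ≡.refl ≡.refl e = e

      elliptic₁₀Below-induction : ∀ {A} →
        (∀ n → 3 ≤ n → n ≤ A ∸ 2 → Elliptic R h n 2 1 0) → (∀ n → 1 ≤ n → n ≤ A ∸ 4 → NZD (h n)) →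
        ∀ N → N ≤ suc A → Elliptic₁₀Below N
      elliptic₁₀Below-induction {A} E₂ nz = below
        where
        top : ∀ {u v} → v < u → u + v ≤ A → Elliptic₁₀Below (u + v) → Elliptic₁₀ u v
        top {u}     {zero}              _   _     _     = elliptic₁₀-zero u
        top {zero}  {suc _}             ()
        top {suc u} {suc zero}          _   _     _     = elliptic₁₀-one u
        top {suc u} {suc (suc zero)}    2<u u+2≤A _     =
          elliptic⇒elliptic₁₀ u 1 (E₂ (suc u) 2<u (ℕ.m+n≤o⇒m≤o∸n (suc u) u+2≤A))
        top {suc u} {suc (suc (suc v))} v<u u+v≤A lower =
          elliptic₁₀-step (s≤s (s≤s (s≤s z≤n))) v<u
            (λ {i} 2<i i≤ → E₂ i 2<i (ℕ.≤-trans i≤ (ℕ.∸-monoˡ-≤ 2 u+v≤A)))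
            (λ {i} 0<i i≤ → nz i 0<i (ℕ.≤-trans i≤ (ℕ.∸-monoˡ-≤ 4 u+v≤A)))
            lower
        below : ∀ N → N ≤ suc A → Elliptic₁₀Below N
        below zero    _     _   ()
        below (suc N) N<1+A {u} {v} v<u u+v<1+N with ℕ.m<1+n⇒m<n∨m≡n u+v<1+N
        ... | inj₁ u+v<N  = below N (ℕ.<⇒≤ N<1+A) v<u u+v<N
        ... | inj₂ ≡.refl = top v<u (ℕ.≤-pred N<1+A) (below (u + v) (ℕ.<⇒≤ N<1+A))

  -- The hypotheses never mention h 0, while the argument needs h 0 = 0; it is run on this sequence.
  zero-at-0 : (ℕ → Carrier) → ℕ → Carrier
  zero-at-0 h zero    = 0#
  zero-at-0 h (suc n) = h (suc n)

  elliptic-cong : ∀ {f g : ℕ → Carrier} {a b c d} → (∀ {n} → 0 < n → f n ≈ g n) →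
    d < c → c < b → b < a → Elliptic R f a b c d → Elliptic R g a b c d
  elliptic-cong {f} {g} {a} {b} {c} {d} f≈g d<c c<b b<a e = three-term-cong e
    (product (pos+ 0<a) (ℕ.m<n⇒0<n∸m b<a) (pos+ 0<c) (ℕ.m<n⇒0<n∸m d<c))
    (product (pos+ 0<a) (ℕ.m<n⇒0<n∸m c<a) (pos+ 0<b) (ℕ.m<n⇒0<n∸m d<b))
    (product (pos+ 0<b) (ℕ.m<n⇒0<n∸m c<b) (pos+ 0<a) (ℕ.m<n⇒0<n∸m d<a))
    where
    product : ∀ {i j k l} → 0 < i → 0 < j → 0 < k → 0 < l →
      f i * f j * f k * f l ≈ g i * g j * g k * g l
    product 0<i 0<j 0<k 0<l = *-cong (*-cong (*-cong (f≈g 0<i) (f≈g 0<j)) (f≈g 0<k)) (f≈g 0<l)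
    pos+ : ∀ {m n} → 0 < m → 0 < m + n
    pos+ {m} {n} 0<m = ℕ.≤-trans 0<m (ℕ.m≤m+n m n)
    0<c = ℕ.≤-trans (s≤s z≤n) d<c
    0<b = ℕ.<-trans 0<c c<b
    0<a = ℕ.<-trans 0<b b<a
    c<a = ℕ.<-trans c<b b<a
    d<b = ℕ.<-trans d<c c<b
    d<a = ℕ.<-trans d<b b<a

theorem2p4 : ∀ {c ℓ} (R : CommutativeRing c ℓ) (h : ℕ → CommutativeRing.Carrier R)
    (a b c d : ℕ) → b < a → c < b → d < c →
    (∀ n → 3 ≤ n → n ≤ (a + b) ∸ 2 → Elliptic R h n 2 1 0) →
    (∀ n → 1 ≤ n → n ≤ (a + b) ∸ 4 → NotZeroDivisor R (h n)) →
    Elliptic R h a b c d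
theorem2p4 R h a b c d b<a c<b d<c E₂ nz =
  elliptic-cong h̃≈h d<c c<b b<a
    (elliptic₁₀Below⇒ellipticBelow h̃ (nz 1 (s≤s z≤n) 1≤a+b∸4)
      (elliptic₁₀Below-induction h̃ refl E₂′ nz′ (suc (a + b)) ℕ.≤-refl) d<c c<b b<a ℕ.≤-refl)
  where
  open EllipticSequences R
  open CommutativeRing R using (_≈_; refl)
  h̃ = zero-at-0 h
  h̃≈h : ∀ {n} → 0 < n → h̃ n ≈ h n
  h̃≈h {suc n} _ = refl
  E₂′ : ∀ n → 3 ≤ n → n ≤ (a + b) ∸ 2 → Elliptic R h̃ n 2 1 0
  E₂′ n 3≤n@(s≤s (s≤s (s≤s _))) = E₂ n 3≤n
  nz′ : ∀ n → 1 ≤ n → n ≤ (a + b) ∸ 4 → NotZeroDivisor R (h̃ n)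
  nz′ n 1≤n@(s≤s _) = nz n 1≤n
  2≤b = ℕ.≤-trans (s≤s (ℕ.≤-trans (s≤s z≤n) d<c)) c<b
  3≤a = ℕ.≤-trans (s≤s 2≤b) b<a
  1≤a+b∸4 : 1 ≤ (a + b) ∸ 4
  1≤a+b∸4 = ℕ.m+n≤o⇒m≤o∸n 1 (ℕ.+-mono-≤ 3≤a 2≤b)
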